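{- Let $n,m$ be positive integers with $n\le 2^{m-1}-1$. Then there exists a uniquely resolvable multiset $\mathcal{F}$ with respect to $(n,m)$ with $|\mathcal{F}|=g(n,m)$ whose unique resolution $\{A_1,\ldots,A_n\}$ satisfies $|A_i|\ge 2$ for every $i\in[n]$.
   Context: Write $[m]=\{1,\ldots,m\}$. For a multiset $\mathcal{F}=\{C_1,\ldots,C_k\}$ of non-empty subsets of $[m]$ (repetitions allowed; members indexed by $[k]$), a resolution into $n$ classes is a partition $\{A_1,\ldots,A_n\}$ of $[k]$ into $n$ blocks such that for each $i$ the sets $C_j$, $j\in A_i$, are pairwise disjoint with union $[m]$. $\mathcal{F}$ is uniquely resolvable with respect to $(n,m)$ if it has exactly one resolution into $n$ classes (partitions regarded as unordered). $g(n,m)$ is the maximum size $k$ of a uniquely resolvable multiset with respect to $(n,m)$. -}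

module Defs where

open import Data.Nat using (ℕ; _≤_; _^_; _∸_; suc)
open import Data.Fin using (Fin)
open import Data.Fin.Subset using (Subset; _∈_; Nonempty)
open import Data.Product using (Σ; ∃; _×_)
open import Relation.Binary.PropositionalEquality using (_≡_; _≢_)
open import Relation.Nullary using (¬_)
open import Data.Empty using (⊥)
open import Function.Bundles using (_⇔_)

-- A multiset of k subsets of [m] = Fin m, indexed by [k] = Fin k.
Family : ℕ → ℕ → Set
Family k m = Fin k → Subset m

NonemptyMembers : ∀ {k m} → Family k m → Set
NonemptyMembers {k} C = (j : Fin k) → Nonempty (C j)

-- A partition of [k] into n blocks, encoded by a block labelling
-- c : Fin k → Fin n that is surjective (every block A_i = c⁻¹(i) non-empty).
Surjective : ∀ {k n} → (Fin k → Fin n) → Set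
Surjective {k} {n} c = (i : Fin n) → ∃ λ (j : Fin k) → c j ≡ i

IsResolution : ∀ {k m} (n : ℕ) → Family k m → (Fin k → Fin n) → Set
IsResolution {k} {m} n C c =
  Surjective c ×
  ((i : Fin n) →
     ((x : Fin m) → ∃ λ (j : Fin k) → (c j ≡ i) × (x ∈ C j)) ×
     ((j j' : Fin k) → c j ≡ i → c j' ≡ i → j ≢ j' →
        (x : Fin m) → x ∈ C j → x ∈ C j' → ⊥))

-- Two labellings define the same (unordered) partition iff they have the same
-- blocks, i.e. j, j' lie in a common block under c iff they do under c'.
SamePartition : ∀ {k n} → (Fin k → Fin n) → (Fin k → Fin n) → Set
SamePartition {k} c c' = (j j' : Fin k) → (c j ≡ c j') ⇔ (c' j ≡ c' j')

UniqueResolution : ∀ {k m} (n : ℕ) → Family k m → (Fin k → Fin n) → Set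
UniqueResolution {k} n C c =
  IsResolution n C c ×
  ((c' : Fin k → Fin n) → IsResolution n C c' → SamePartition c c')

UniquelyResolvable : ∀ {k m} (n : ℕ) → Family k m → Set
UniquelyResolvable {k} n C = ∃ λ (c : Fin k → Fin n) → UniqueResolution n C c

URFamily : ℕ → ℕ → ℕ → Set
URFamily n m k = Σ (Family k m) λ C → NonemptyMembers C × UniquelyResolvable n C

IsG : ℕ → ℕ → ℕ → Set
IsG n m k = URFamily n m k × ((k' : ℕ) → URFamily n m k' → k' ≤ k)

BlocksAtLeastTwo : ∀ {k n} → (Fin k → Fin n) → Set
BlocksAtLeastTwo {k} {n} c =
  (i : Fin n) → ∃ λ (j : Fin k) → ∃ λ (j' : Fin k) → (j ≢ j') × (c j ≡ i) × (c j' ≡ i)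

-- A class of a resolution with a single member consists of [m]. Replacing that
-- member by S and ∁ S keeps the family uniquely resolvable as long as S is not a
-- union of members of any single class: a second resolution that separates S
-- from ∁ S could be exchanged into one that puts them together, and merging
-- them back gives a second resolution of the original family. Now take a
-- uniquely resolvable family of maximum size g(n, m) and repair its singleton
-- classes one at a time. If some class has three members a, b, t, merge a into
-- b and split [m] into C a and its complement; the size is unchanged and C a is
-- not a union of members of another class, for otherwise exchanging a with
-- those members would give a second resolution. If every class has at most two
-- members, maximality rules out a split, so every nonempty subset of [m] is a
-- member; then a subset is determined by its class and by whether it contains
-- the point 0, whence 2^m ≤ 2n, contradicting n ≤ 2^(m-1) - 1.

module Submission where

open import Defs
open import Data.Bool using (Bool; false)
import Data.Bool as Bool
open import Data.Empty using (⊥; ⊥-elim)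
open import Data.Fin using (Fin; zero; suc; _≟_; punchIn; punchOut; combine; finToFun; funToFin)
open import Data.Fin.Properties
  using (any?; all?; suc-injective; punchInᵢ≢i; punchOut-cong; punchOut-punchIn; punchIn-punchOut;
         combine-injective; injective⇒≤; funToFin-finToFin; 2↔Bool)
open import Data.Fin.Subset using (Subset; _∈_; _⊆_; Nonempty; ∁; ⊤; _∪_)
open import Data.Fin.Subset.Properties
  using (_∈?_; _⊆?_; nonempty?; anySubset?; ∈⊤; ⊆-antisym; p∪∁p≡⊤;
         x∈∁p⇒x∉p; x∉p⇒x∈∁p; x∈p⇒x∉∁p; x∉∁p⇒x∈p; x∈p∪q⁻; x∈p∪q⁺)
open import Data.List as List using (List; allFin)
open import Data.List.Membership.Propositional.Properties using (∈-allFin)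
open import Data.List.Relation.Unary.Any using (here; there)
import Data.List.Membership.Propositional as ListMembership
open import Data.Nat using (ℕ; zero; suc; _≤_; _<_; _*_; _^_; _∸_; s≤s)
open import Data.Nat.Properties using (≤-pred; ≤∧≢⇒<; n≤0⇒n≡0; 1+n≰n; <⇒≱; *-comm; *-monoˡ-<; m^n>0)
open import Data.Product using (Σ; ∃; _×_; _,_; proj₁; proj₂)
open import Data.Sum using (_⊎_; inj₁; inj₂)
open import Data.Vec using (tabulate; lookup)
open import Data.Vec.Properties using (lookup∘tabulate; ≡-dec)
open import Data.Vec.Functional using (_∷_; head; tail; updateAt)
open import Data.Vec.Functional.Properties using (updateAt-updates; updateAt-minimal)
open import Function using (_∘_; id)
open import Function.Bundles using (_⇔_; mk⇔; Equivalence; Inverse)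
open import Relation.Nullary using (¬_; Dec; yes; no; does)
open import Relation.Nullary.Decidable using (_×-dec_; _→-dec_; ¬?; map′; decidable-stable; dec-true)
open import Relation.Unary using (Decidable)
open import Relation.Binary.PropositionalEquality
  using (_≡_; _≢_; _≗_; refl; sym; trans; subst; subst₂; cong; cong₂)

private variable
  k m n : ℕ

HasTwo : (Fin k → Fin n) → Fin n → Set
HasTwo c i = ∃ λ j → ∃ λ j' → (j ≢ j') × (c j ≡ i) × (c j' ≡ i)

SingletonClass : (Fin k → Fin n) → Fin k → Set
SingletonClass c j₀ = ∀ {j} → c j ≡ c j₀ → j ≡ j₀

ThreeInClass : (Fin k → Fin n) → Set
ThreeInClass c = ∃ λ a → ∃ λ b → ∃ λ t → a ≢ b × a ≢ t × b ≢ t × c b ≡ c a × c t ≡ c a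

-- For a resolution c this says that S is a union of members of class i.
ClassRefines : Family k m → (Fin k → Fin n) → Fin n → Subset m → Set
ClassRefines C c i S = ∀ j → c j ≡ i → C j ⊆ S ⊎ C j ⊆ ∁ S

∁∁ : ∀ (S : Subset m) → ∁ (∁ S) ≡ S
∁∁ S = ⊆-antisym (x∉∁p⇒x∈p ∘ x∈∁p⇒x∉p) (x∉p⇒x∈∁p ∘ x∈p⇒x∉∁p)

empty-unique : ∀ {S S' : Subset m} → ¬ Nonempty S → ¬ Nonempty S' → S ≡ S'
empty-unique ¬ne ¬ne' = ⊆-antisym (λ {x} x∈ → ⊥-elim (¬ne (x , x∈))) (λ {x} x∈ → ⊥-elim (¬ne' (x , x∈)))

∁-empty⇒⊤ : ∀ {S : Subset m} → ¬ Nonempty (∁ S) → S ≡ ⊤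
∁-empty⇒⊤ ¬ne = ⊆-antisym (λ _ → ∈⊤) (λ {x} _ → x∉∁p⇒x∈p (λ x∈ → ¬ne (x , x∈)))

side-⊆ : ∀ {U V S : Subset m} → U ⊆ V → V ⊆ S ⊎ V ⊆ ∁ S → U ⊆ S ⊎ U ⊆ ∁ S
side-⊆ U⊆V (inj₁ V⊆S)  = inj₁ (λ x∈ → V⊆S (U⊆V x∈))
side-⊆ U⊆V (inj₂ V⊆∁S) = inj₂ (λ x∈ → V⊆∁S (U⊆V x∈))

_≟ₛ_ : ∀ (S S' : Subset m) → Dec (S ≡ S')
_≟ₛ_ = ≡-dec Bool._≟_

module _ {C C' : Family k m} {c c' : Fin k → Fin n} (C≗C' : C ≗ C') (c≗c' : c ≗ c') where

  isResolution-cong : IsResolution n C c → IsResolution n C' c'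
  isResolution-cong (surj , res) =
    (λ i → let (j , cj) = surj i in j , trans (sym (c≗c' j)) cj) ,
    λ i → (λ x → let (j , cj , x∈) = proj₁ (res i) x in
                   j , trans (sym (c≗c' j)) cj , subst (x ∈_) (C≗C' j) x∈) ,
          λ j j' cj cj' j≢j' x x∈ x∈' →
            proj₂ (res i) j j' (trans (c≗c' j) cj) (trans (c≗c' j') cj') j≢j' x
              (subst (x ∈_) (sym (C≗C' j)) x∈) (subst (x ∈_) (sym (C≗C' j')) x∈')

samePartition-cong : {c₁ c₂ c₁' c₂' : Fin k → Fin n} → c₁ ≗ c₂ → c₁' ≗ c₂' →
                     SamePartition c₁ c₁' → SamePartition c₂ c₂'
samePartition-cong e e' sp j j' =
  subst₂ _⇔_ (cong₂ _≡_ (e j) (e j')) (cong₂ _≡_ (e' j) (e' j')) (sp j j')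

uniqueResolution-cong : {C C' : Family k m} {c c' : Fin k → Fin n} → C ≗ C' → c ≗ c' →
                        UniqueResolution n C c → UniqueResolution n C' c'
uniqueResolution-cong C≗C' c≗c' (res , unique) =
  isResolution-cong C≗C' c≗c' res ,
  λ b res-b → samePartition-cong c≗c' (λ _ → refl)
                (unique b (isResolution-cong (sym ∘ C≗C') (λ _ → refl) res-b))

samePartition-∷ : {c c' : Fin k → Fin n} → SamePartition c c' → ∀ j₀ →
                  SamePartition (c j₀ ∷ c) (c' j₀ ∷ c')
samePartition-∷ sp j₀ zero    zero     = mk⇔ (λ _ → refl) (λ _ → refl)
samePartition-∷ sp j₀ zero    (suc j') = sp j₀ j'
samePartition-∷ sp j₀ (suc j) zero     = sp j j₀
samePartition-∷ sp j₀ (suc j) (suc j') = sp j j'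

-- Resolutions as tilings

record Tiles (C : Family k m) (P : Fin k → Set) (T : Subset m) : Set where
  field
    inside   : ∀ {j} → P j → C j ⊆ T
    covers   : ∀ {x} → x ∈ T → ∃ λ j → P j × x ∈ C j
    disjoint : ∀ {j j' x} → P j → P j' → j ≢ j' → x ∈ C j → x ∈ C j' → ⊥

open Tiles

module _ {C : Family k m} where

  resolution⇒tiles : ∀ {c : Fin k → Fin n} → IsResolution n C c → ∀ l → Tiles C (λ j → c j ≡ l) ⊤
  resolution⇒tiles (_ , res) l = record
    { inside   = λ _ _ → ∈⊤
    ; covers   = λ {x} _ → proj₁ (res l) x
    ; disjoint = λ {j} {j'} {x} cj cj' j≢j' → proj₂ (res l) j j' cj cj' j≢j' x
    }

  tiles⇒resolution : ∀ {c : Fin k → Fin n} → Surjective c → (∀ l → Tiles C (λ j → c j ≡ l) ⊤) →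
                     IsResolution n C c
  tiles⇒resolution surj t =
    surj , λ l → (λ x → covers (t l) ∈⊤) , λ j j' cj cj' j≢j' x → disjoint (t l) cj cj' j≢j'

  tiles⇒surjective : ∀ {c : Fin k → Fin n} → Fin m → (∀ l → Tiles C (λ j → c j ≡ l) ⊤) → Surjective c
  tiles⇒surjective x t l = let (j , cj , _) = covers (t l) (∈⊤ {x = x}) in j , cj

  tiles-cong : ∀ {P Q : Fin k → Set} {T} → (∀ {j} → P j → Q j) → (∀ {j} → Q j → P j) →
               Tiles C P T → Tiles C Q T
  tiles-cong P⇒Q Q⇒P t = record
    { inside   = λ q → inside t (Q⇒P q)
    ; covers   = λ x∈T → let (j , p , x∈) = covers t x∈T in j , P⇒Q p , x∈
    ; disjoint = λ q q' → disjoint t (Q⇒P q) (Q⇒P q')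
    }

  tiles-singleton : ∀ j → Tiles C (_≡ j) (C j)
  tiles-singleton j = record
    { inside   = λ { refl x∈ → x∈ }
    ; covers   = λ x∈ → j , refl , x∈
    ; disjoint = λ j₁≡j j₂≡j j₁≢j₂ _ _ → j₁≢j₂ (trans j₁≡j (sym j₂≡j))
    }

  tiles-diff : ∀ {P Q : Fin k → Set} {T} → Tiles C P ⊤ → (∀ {j} → Q j → P j) → Tiles C Q T →
               Tiles C (λ j → P j × ¬ Q j) (∁ T)
  tiles-diff {Q = Q} tP Q⇒P tQ = record
    { inside   = λ (p , ¬q) x∈ → x∉p⇒x∈∁p λ x∈T →
                   let (j' , q' , x∈') = covers tQ x∈T in
                   disjoint tP p (Q⇒P q') (λ j≡j' → ¬q (subst Q (sym j≡j') q')) x∈ x∈'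
    ; covers   = λ x∈∁T → let (j , p , x∈) = covers tP ∈⊤ in
                   j , (p , λ q → x∈∁p⇒x∉p x∈∁T (inside tQ q x∈)) , x∈
    ; disjoint = λ (p , _) (p' , _) → disjoint tP p p'
    }

  tiles-⊎ : ∀ {P Q : Fin k → Set} {T} → Tiles C P T → Tiles C Q (∁ T) → Tiles C (λ j → P j ⊎ Q j) ⊤
  tiles-⊎ {P = P} {Q} {T} tP tQ = record
    { inside   = λ _ _ → ∈⊤
    ; covers   = cover
    ; disjoint = apart
    }
    where
    cover : ∀ {x} → x ∈ ⊤ → ∃ λ j → (P j ⊎ Q j) × x ∈ C j
    cover {x} _ with x ∈? T
    ... | yes x∈T = let (j , p , x∈) = covers tP x∈T in j , inj₁ p , x∈
    ... | no x∉T  = let (j , q , x∈) = covers tQ (x∉p⇒x∈∁p x∉T) in j , inj₂ q , x∈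
    apart : ∀ {j j' x} → P j ⊎ Q j → P j' ⊎ Q j' → j ≢ j' → x ∈ C j → x ∈ C j' → ⊥
    apart (inj₁ p) (inj₁ p') j≢j' = disjoint tP p p' j≢j'
    apart (inj₂ q) (inj₂ q') j≢j' = disjoint tQ q q' j≢j'
    apart (inj₁ p) (inj₂ q') _ x∈ x∈' = x∈∁p⇒x∉p (inside tQ q' x∈') (inside tP p x∈)
    apart (inj₂ q) (inj₁ p') _ x∈ x∈' = x∈∁p⇒x∉p (inside tQ q x∈) (inside tP p' x∈')

  tiles-restrict : ∀ {P : Fin k → Set} {D} → Tiles C P ⊤ → (∀ j → P j → C j ⊆ D ⊎ C j ⊆ ∁ D) →
                   Tiles C (λ j → P j × C j ⊆ D) D
  tiles-restrict {P = P} {D} tP side = record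
    { inside   = proj₂
    ; covers   = cover
    ; disjoint = λ (p , _) (p' , _) → disjoint tP p p'
    }
    where
    cover : ∀ {x} → x ∈ D → ∃ λ j → (P j × C j ⊆ D) × x ∈ C j
    cover x∈D with covers tP ∈⊤
    ... | j , p , x∈ with side j p
    ...   | inj₁ j⊆D  = j , (p , j⊆D) , x∈
    ...   | inj₂ j⊆∁D = ⊥-elim (x∈∁p⇒x∉p (j⊆∁D x∈) x∈D)

members-disjoint : {C : Family k m} {c : Fin k → Fin n} → IsResolution n C c →
                   ∀ {j j' x} → c j ≡ c j' → j ≢ j' → x ∈ C j → x ∈ C j' → ⊥
members-disjoint res cj≡cj' = disjoint (resolution⇒tiles res _) cj≡cj' refl

singleton-full : ∀ {C : Family k m} {c : Fin k → Fin n} {j₀} → IsResolution n C c → SingletonClass c j₀ →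
                 C j₀ ≡ ⊤
singleton-full {C = C} {c} {j₀} res single = ⊆-antisym (λ _ → ∈⊤) λ {x} _ →
  let (j , cj , x∈) = covers (resolution⇒tiles res (c j₀)) ∈⊤ in subst (λ i → x ∈ C i) (single cj) x∈

classRefines-transfer : ∀ {C : Family k m} {c c' : Fin k → Fin n} {T} → SamePartition c c' →
                        ∀ j → ClassRefines C c' (c' j) T → ClassRefines C c (c j) T
classRefines-transfer sp j ref j' cj'≡cj = ref j' (Equivalence.to (sp j' j) cj'≡cj)

-- Existence of g(n, m)

Searchable : Set → Set₁
Searchable A = ∀ {P : A → Set} → Decidable P → Dec (∃ P)

Extensional : ∀ {A : Set} → ((Fin k → A) → Set) → Set
Extensional P = ∀ {f g} → f ≗ g → P f → P g

∃-function? : ∀ {A} → Searchable A → ∀ k {P : (Fin k → A) → Set} → Extensional P → Decidable P → Dec (∃ P)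
∃-function? search zero    ext P? = map′ (λ p → _ , p) (λ (f , p) → ext (λ ()) p) (P? (λ ()))
∃-function? search (suc k) ext P? =
  map′ (λ (a , f , p) → a ∷ f , p) (λ (f , p) → head f , tail f , ext (λ { zero → refl ; (suc _) → refl }) p)
    (search λ a → ∃-function? search k (λ f≗g → ext λ { zero → refl ; (suc i) → f≗g i }) (P? ∘ (a ∷_)))

∀-function? : ∀ {A} → Searchable A → ∀ k {P : (Fin k → A) → Set} → Extensional P → Decidable P →
              Dec (∀ f → P f)
∀-function? search k ext P? =
  map′ (λ ¬∃ f → decidable-stable (P? f) (λ ¬p → ¬∃ (f , ¬p))) (λ ∀p (f , ¬p) → ¬p (∀p f))
    (¬? (∃-function? search k (λ f≗g ¬pf pg → ¬pf (ext (sym ∘ f≗g) pg)) (¬? ∘ P?)))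

_⇔?_ : ∀ {A B : Set} → Dec A → Dec B → Dec (A ⇔ B)
a? ⇔? b? = map′ (λ (f , g) → mk⇔ f g) (λ e → Equivalence.to e , Equivalence.from e)
  ((a? →-dec b?) ×-dec (b? →-dec a?))

isResolution? : ∀ n (C : Family k m) c → Dec (IsResolution n C c)
isResolution? n C c =
  (all? λ i → any? λ j → c j ≟ i) ×-dec
  all? λ i → (all? λ x → any? λ j → (c j ≟ i) ×-dec (x ∈? C j)) ×-dec
             (all? λ j → all? λ j' → (c j ≟ i) →-dec (c j' ≟ i) →-dec ¬? (j ≟ j') →-dec
                all? λ x → (x ∈? C j) →-dec (x ∈? C j') →-dec no id)

samePartition? : ∀ (c c' : Fin k → Fin n) → Dec (SamePartition c c')
samePartition? c c' = all? λ j → all? λ j' → (c j ≟ c j') ⇔? (c' j ≟ c' j')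

uniqueResolution? : ∀ n (C : Family k m) c → Dec (UniqueResolution n C c)
uniqueResolution? {k} n C c = isResolution? n C c ×-dec
  ∀-function? any? k
    (λ c'≗c'' h res'' →
       samePartition-cong (λ _ → refl) c'≗c'' (h (isResolution-cong (λ _ → refl) (sym ∘ c'≗c'') res'')))
    (λ c' → isResolution? n C c' →-dec samePartition? c c')

urFamily? : ∀ n m k → Dec (URFamily n m k)
urFamily? n m k = ∃-function? anySubset? k
  (λ C≗C' (nonempty , c , ur) →
     (λ j → let (x , x∈) = nonempty j in x , subst (x ∈_) (C≗C' j) x∈) ,
     c , uniqueResolution-cong C≗C' (λ _ → refl) ur)
  (λ C → (all? λ j → nonempty? (C j)) ×-dec
         ∃-function? any? k (λ c≗c' → uniqueResolution-cong (λ _ → refl) c≗c') (uniqueResolution? n C))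

size-bound : URFamily n m k → k ≤ n * m
size-bound {n} {m} {k} (C , nonempty , c , res , _) = injective⇒≤ {f = code} code-injective
  where
  code : Fin k → Fin (n * m)
  code j = combine (c j) (proj₁ (nonempty j))
  code-injective : ∀ {j j'} → code j ≡ code j' → j ≡ j'
  code-injective {j} {j'} eq with j ≟ j'
  ... | yes j≡j' = j≡j'
  ... | no j≢j'  =
    let (cj≡cj' , x≡x') = combine-injective (c j) _ (c j') _ eq in
    ⊥-elim (members-disjoint res cj≡cj' j≢j' (proj₂ (nonempty j))
                               (subst (_∈ C j') (sym x≡x') (proj₂ (nonempty j'))))

full-family : URFamily n (suc m) n
full-family = (λ _ → ⊤) , (λ _ → zero , ∈⊤) , id , resolution , unique
  where
  resolution : IsResolution _ (λ _ → ⊤) id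
  resolution = (λ i → i , refl) ,
               λ i → (λ _ → i , refl , ∈⊤) , λ j j' j≡i j'≡i j≢j' _ _ _ → j≢j' (trans j≡i (sym j'≡i))
  unique : ∀ c → IsResolution _ (λ _ → ⊤) c → SamePartition id c
  unique c res j j' = mk⇔ (cong c) λ cj≡cj' → decide cj≡cj' (j ≟ j')
    where
    decide : c j ≡ c j' → Dec (j ≡ j') → j ≡ j'
    decide _      (yes j≡j') = j≡j'
    decide cj≡cj' (no j≢j')  = ⊥-elim (members-disjoint res cj≡cj' j≢j' (∈⊤ {x = zero}) ∈⊤)

largest : ∀ {P : ℕ → Set} → Decidable P → ∀ u → (∀ b → P b → b ≤ u) → ∃ P →
          ∃ λ k → P k × (∀ b → P b → b ≤ k)
largest P? u bound ∃P with P? u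
... | yes Pu = u , Pu , bound

largest {P} P? zero    bound (a , Pa) | no ¬Pu = ⊥-elim (¬Pu (subst P (n≤0⇒n≡0 (bound a Pa)) Pa))
largest {P} P? (suc u) bound ∃P       | no ¬Pu =
  largest P? u (λ b Pb → ≤-pred (≤∧≢⇒< (bound b Pb) (λ b≡1+u → ¬Pu (subst P b≡1+u Pb)))) ∃P

g-exists : ∀ n m → ∃ (IsG n (suc m))
g-exists n m = largest (urFamily? n (suc m)) (n * suc m) (λ _ → size-bound) (n , full-family)

module Exchange {C : Family k m} {B : Fin k → Fin n} (res : IsResolution n C B)
                {X Y : Fin n} (X≢Y : X ≢ Y)
                {A A' : Fin k → Set} (A? : Decidable A) (A'? : Decidable A')
                (A⇒X : ∀ {j} → A j → B j ≡ X) (A'⇒Y : ∀ {j} → A' j → B j ≡ Y)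
                {T : Subset m} (tA : Tiles C A T) (tA' : Tiles C A' T) where

  relabel : Fin k → Fin n
  relabel j with A? j | A'? j
  ... | yes _ | _     = Y
  ... | no _  | yes _ = X
  ... | no _  | no _  = B j

  relabel-unmoved : ∀ {j} → ¬ A j → ¬ A' j → relabel j ≡ B j
  relabel-unmoved {j} ¬a ¬a' with A? j | A'? j
  ... | yes a | _      = ⊥-elim (¬a a)
  ... | no _  | yes a' = ⊥-elim (¬a' a')
  ... | no _  | no _   = refl

  relabel≡X⁻ : ∀ {j} → relabel j ≡ X → A' j ⊎ (B j ≡ X × ¬ A j)
  relabel≡X⁻ {j} eq with A? j | A'? j
  ... | yes _ | _      = ⊥-elim (X≢Y (sym eq))
  ... | no _  | yes a' = inj₁ a'
  ... | no ¬a | no _   = inj₂ (eq , ¬a)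

  relabel≡X⁺ : ∀ {j} → A' j ⊎ (B j ≡ X × ¬ A j) → relabel j ≡ X
  relabel≡X⁺ {j} h with A? j | A'? j | h
  ... | yes a | _      | inj₁ a'      = ⊥-elim (X≢Y (trans (sym (A⇒X a)) (A'⇒Y a')))
  ... | yes a | _      | inj₂ (_ , ¬a) = ⊥-elim (¬a a)
  ... | no _  | yes _  | _            = refl
  ... | no _  | no ¬a' | inj₁ a'      = ⊥-elim (¬a' a')
  ... | no _  | no _   | inj₂ (eq , _) = eq

  relabel≡Y⁻ : ∀ {j} → relabel j ≡ Y → A j ⊎ (B j ≡ Y × ¬ A' j)
  relabel≡Y⁻ {j} eq with A? j | A'? j
  ... | yes a | _     = inj₁ a
  ... | no _  | yes _ = ⊥-elim (X≢Y eq)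
  ... | no _  | no ¬a' = inj₂ (eq , ¬a')

  relabel≡Y⁺ : ∀ {j} → A j ⊎ (B j ≡ Y × ¬ A' j) → relabel j ≡ Y
  relabel≡Y⁺ {j} h with A? j | A'? j | h
  ... | yes _ | _      | _             = refl
  ... | no ¬a | _      | inj₁ a        = ⊥-elim (¬a a)
  ... | no _  | yes a' | inj₂ (_ , ¬a') = ⊥-elim (¬a' a')
  ... | no _  | no _   | inj₂ (eq , _)  = eq

  relabel≡other⁻ : ∀ {j l} → l ≢ X → l ≢ Y → relabel j ≡ l → B j ≡ l
  relabel≡other⁻ {j} l≢X l≢Y eq with A? j | A'? j
  ... | yes _ | _     = ⊥-elim (l≢Y (sym eq))
  ... | no _  | yes _ = ⊥-elim (l≢X (sym eq))
  ... | no _  | no _  = eq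

  relabel≡other⁺ : ∀ {j l} → l ≢ X → l ≢ Y → B j ≡ l → relabel j ≡ l
  relabel≡other⁺ {j} l≢X l≢Y eq with A? j | A'? j
  ... | yes a | _      = ⊥-elim (l≢X (trans (sym eq) (A⇒X a)))
  ... | no _  | yes a' = ⊥-elim (l≢Y (trans (sym eq) (A'⇒Y a')))
  ... | no _  | no _   = eq

  class : ∀ l → Tiles C (λ j → B j ≡ l) ⊤
  class = resolution⇒tiles res

  stay-Y : Tiles C (λ j → B j ≡ Y × ¬ A' j) (∁ T)
  stay-Y = tiles-diff (class Y) A'⇒Y tA'

  relabel-tiles : ∀ l → Tiles C (λ j → relabel j ≡ l) ⊤
  relabel-tiles l with l ≟ X | l ≟ Y
  ... | yes refl | _     = tiles-cong relabel≡X⁺ relabel≡X⁻ (tiles-⊎ tA' (tiles-diff (class X) A⇒X tA))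
  ... | no _     | yes refl = tiles-cong relabel≡Y⁺ relabel≡Y⁻ (tiles-⊎ tA stay-Y)
  ... | no l≢X   | no l≢Y = tiles-cong (relabel≡other⁺ l≢X l≢Y) (relabel≡other⁻ l≢X l≢Y) (class l)

  relabel-resolution : Fin m → IsResolution n C relabel
  relabel-resolution x = tiles⇒resolution (tiles⇒surjective x relabel-tiles) relabel-tiles

  relabel-refines : ClassRefines C relabel Y T
  relabel-refines j eq with relabel≡Y⁻ eq
  ... | inj₁ a    = inj₁ (inside tA a)
  ... | inj₂ stay = inj₂ (inside stay-Y stay)

-- Merging the member d into d': the merged family is indexed by Fin k through
-- punchIn d, and restore sends d to the index of the merged member.
module Merge {k m} (C : Family (suc k) m) {d d' : Fin (suc k)} (d≢d' : d ≢ d') where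

  e : Fin k
  e = punchOut d≢d'

  merged : Family k m
  merged = updateAt (C ∘ punchIn d) e (_∪ C d)

  restore : Fin (suc k) → Fin k
  restore j with j ≟ d
  ... | yes _   = e
  ... | no j≢d = punchOut (j≢d ∘ sym)

  punchIn-e : punchIn d e ≡ d'
  punchIn-e = punchIn-punchOut d≢d'

  restore-punchIn : ∀ u → restore (punchIn d u) ≡ u
  restore-punchIn u with punchIn d u ≟ d
  ... | yes p = ⊥-elim (punchInᵢ≢i d u p)
  ... | no _  = trans (punchOut-cong d refl) (punchOut-punchIn d)

  punchIn-restore : ∀ {j} → j ≢ d → punchIn d (restore j) ≡ j
  punchIn-restore {j} j≢d with j ≟ d
  ... | yes p   = ⊥-elim (j≢d p)
  ... | no j≢d' = punchIn-punchOut (j≢d' ∘ sym)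

  restore-d : restore d ≡ e
  restore-d with d ≟ d
  ... | yes _ = refl
  ... | no ne = ⊥-elim (ne refl)

  restore-d' : restore d' ≡ e
  restore-d' = trans (cong restore (sym punchIn-e)) (restore-punchIn e)

  restore-injective : ∀ {j j'} → j ≢ d → j' ≢ d → restore j ≡ restore j' → j ≡ j'
  restore-injective j≢d j'≢d eq =
    trans (sym (punchIn-restore j≢d)) (trans (cong (punchIn d) eq) (punchIn-restore j'≢d))

  restore-collision : ∀ {j j'} → j ≢ j' → restore j ≡ restore j' → (j ≡ d × j' ≡ d') ⊎ (j ≡ d' × j' ≡ d)
  restore-collision {j} {j'} j≢j' eq = go (j ≟ d) (j' ≟ d)
    where
    towards-d' : ∀ {i} → i ≢ d → restore i ≡ e → i ≡ d'
    towards-d' i≢d ri≡e = trans (sym (punchIn-restore i≢d)) (trans (cong (punchIn d) ri≡e) punchIn-e)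
    go : Dec (j ≡ d) → Dec (j' ≡ d) → (j ≡ d × j' ≡ d') ⊎ (j ≡ d' × j' ≡ d)
    go (yes j≡d) (yes j'≡d) = ⊥-elim (j≢j' (trans j≡d (sym j'≡d)))
    go (yes j≡d) (no j'≢d)  = inj₁ (j≡d , towards-d' j'≢d (trans (sym eq) (trans (cong restore j≡d) restore-d)))
    go (no j≢d)  (yes j'≡d) = inj₂ (towards-d' j≢d (trans eq (trans (cong restore j'≡d) restore-d)) , j'≡d)
    go (no j≢d)  (no j'≢d)  = ⊥-elim (j≢j' (restore-injective j≢d j'≢d eq))

  merged-e : merged e ≡ C d' ∪ C d
  merged-e = trans (updateAt-updates e (C ∘ punchIn d)) (cong (λ j → C j ∪ C d) punchIn-e)

  merged-other : ∀ {u} → u ≢ e → merged u ≡ C (punchIn d u)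
  merged-other {u} u≢e = updateAt-minimal u e (C ∘ punchIn d) u≢e

  punchIn-⊆-merged : ∀ u → C (punchIn d u) ⊆ merged u
  punchIn-⊆-merged u {x} x∈ with u ≟ e
  ... | yes refl = subst (x ∈_) (sym merged-e) (x∈p∪q⁺ (inj₁ (subst (λ j → x ∈ C j) punchIn-e x∈)))
  ... | no u≢e   = subst (x ∈_) (sym (merged-other u≢e)) x∈

  ∈-merged : ∀ j {x} → x ∈ C j → x ∈ merged (restore j)
  ∈-merged j {x} x∈ = go (j ≟ d)
    where
    go : Dec (j ≡ d) → x ∈ merged (restore j)
    go (yes j≡d) = subst (λ u → x ∈ merged u) (sym (trans (cong restore j≡d) restore-d))
                     (subst (x ∈_) (sym merged-e) (x∈p∪q⁺ (inj₂ (subst (λ i → x ∈ C i) j≡d x∈))))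
    go (no j≢d)  = punchIn-⊆-merged (restore j) (subst (λ i → x ∈ C i) (sym (punchIn-restore j≢d)) x∈)

  merged-∈ : ∀ {x u} → x ∈ merged u → ∃ λ j → restore j ≡ u × x ∈ C j
  merged-∈ {x} {u} x∈ with u ≟ e
  ... | no u≢e   = punchIn d u , restore-punchIn u , subst (x ∈_) (merged-other u≢e) x∈
  ... | yes refl with x∈p∪q⁻ (C d') (C d) (subst (x ∈_) merged-e x∈)
  ...   | inj₁ x∈d' = d' , restore-d' , x∈d'
  ...   | inj₂ x∈d  = d , restore-d , x∈d

  merged-nonempty : NonemptyMembers C → NonemptyMembers merged
  merged-nonempty nonempty u = let (x , x∈) = nonempty (punchIn d u) in x , punchIn-⊆-merged u x∈

  module _ {n} {c : Fin (suc k) → Fin n} (cd≡cd' : c d ≡ c d') where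

    label-restore : ∀ j → c (punchIn d (restore j)) ≡ c j
    label-restore j = go (j ≟ d)
      where
      go : Dec (j ≡ d) → c (punchIn d (restore j)) ≡ c j
      go (yes j≡d) = trans (cong (c ∘ punchIn d) (trans (cong restore j≡d) restore-d))
                       (trans (cong c punchIn-e) (trans (sym cd≡cd') (cong c (sym j≡d))))
      go (no j≢d)  = cong c (punchIn-restore j≢d)

    merged-resolution : IsResolution n C c → IsResolution n merged (c ∘ punchIn d)
    merged-resolution res = tiles⇒resolution surj tiles
      where
      surj : Surjective (c ∘ punchIn d)
      surj l = let (j , cj) = proj₁ res l in restore j , trans (label-restore j) cj
      tiles : ∀ l → Tiles merged (λ u → c (punchIn d u) ≡ l) ⊤
      tiles l = record
        { inside   = λ _ _ → ∈⊤
        ; covers   = λ x∈⊤ → let (j , cj , x∈) = covers (resolution⇒tiles res l) x∈⊤ in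
                       restore j , trans (label-restore j) cj , ∈-merged j x∈
        ; disjoint = apart
        }
        where
        apart : ∀ {u w x} → c (punchIn d u) ≡ l → c (punchIn d w) ≡ l → u ≢ w →
                x ∈ merged u → x ∈ merged w → ⊥
        apart cu cw u≢w x∈u x∈w with merged-∈ x∈u | merged-∈ x∈w
        ... | j , refl , x∈j | j' , refl , x∈j' =
          members-disjoint res (trans (sym (label-restore j)) (trans cu (trans (sym cw) (label-restore j'))))
            (λ { refl → u≢w refl }) x∈j x∈j'

  lifted-resolution : ∀ {n} {b : Fin k → Fin n} → (∀ {x} → x ∈ C d → x ∈ C d' → ⊥) →
                      IsResolution n merged b → IsResolution n C (b ∘ restore)
  lifted-resolution {b = b} d∩d'≡∅ res = tiles⇒resolution surj tiles
    where
    surj : Surjective (b ∘ restore)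
    surj l = let (u , bu) = proj₁ res l in punchIn d u , trans (cong b (restore-punchIn u)) bu
    tiles : ∀ l → Tiles C (λ j → b (restore j) ≡ l) ⊤
    tiles l = record
      { inside   = λ _ _ → ∈⊤
      ; covers   = λ x∈⊤ → let (u , bu , x∈u) = covers (resolution⇒tiles res l) x∈⊤
                               (j , rj , x∈j) = merged-∈ x∈u in
                           j , trans (cong b rj) bu , x∈j
      ; disjoint = apart
      }
      where
      apart : ∀ {j j' x} → b (restore j) ≡ l → b (restore j') ≡ l → j ≢ j' → x ∈ C j → x ∈ C j' → ⊥
      apart {j} {j'} bj bj' j≢j' x∈ x∈' with restore j ≟ restore j'
      ... | no rj≢rj' = disjoint (resolution⇒tiles res l) bj bj' rj≢rj' (∈-merged j x∈) (∈-merged j' x∈')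
      ... | yes rj≡rj' with restore-collision j≢j' rj≡rj'
      ...   | inj₁ (refl , refl) = d∩d'≡∅ x∈ x∈'
      ...   | inj₂ (refl , refl) = d∩d'≡∅ x∈' x∈

  merged-unique : ∀ {n} {c : Fin (suc k) → Fin n} → UniqueResolution n C c → c d ≡ c d' →
                  UniqueResolution n merged (c ∘ punchIn d)
  merged-unique {c = c} (res , unique) cd≡cd' =
    merged-resolution cd≡cd' res ,
    λ b res-b → restrict (unique (b ∘ restore) (lifted-resolution (members-disjoint res cd≡cd' d≢d') res-b))
    where
    restrict : ∀ {b} → SamePartition c (b ∘ restore) → SamePartition (c ∘ punchIn d) b
    restrict {b} sp u w = subst₂ (λ v v' → (c (punchIn d u) ≡ c (punchIn d w)) ⇔ (b v ≡ b v'))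
                            (restore-punchIn u) (restore-punchIn w) (sp (punchIn d u) (punchIn d w))

split : Family k m → Fin k → Subset m → Family (suc k) m
split C j₀ S = ∁ S ∷ updateAt C j₀ (λ _ → S)

split-nonempty : ∀ {C : Family k m} {j₀ S} → NonemptyMembers C → Nonempty S → Nonempty (∁ S) →
                 NonemptyMembers (split C j₀ S)
split-nonempty neC neS ne∁S zero = ne∁S
split-nonempty {C = C} {j₀} neC neS ne∁S (suc j) with j ≟ j₀
... | yes refl = subst Nonempty (sym (updateAt-updates j₀ C)) neS
... | no j≢j₀  = subst Nonempty (sym (updateAt-minimal j j₀ C j≢j₀)) (neC j)

module Split {C : Family k m} {c : Fin k → Fin n} (ur : UniqueResolution n C c)
             {j₀ : Fin k} (single : SingletonClass c j₀) (S : Subset m) where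

  private
    res : IsResolution n C c
    res = proj₁ ur
    CS : Family (suc k) m
    CS = split C j₀ S

  open Merge CS {zero} {suc j₀} (λ ())
    using (merged; merged-e; merged-other; merged-resolution; lifted-resolution;
           restore; restore-d; restore-punchIn)

  S-member : CS (suc j₀) ≡ S
  S-member = updateAt-updates j₀ C

  merged≗C : merged ≗ C
  merged≗C u with u ≟ j₀
  ... | yes refl = trans merged-e (trans (cong (_∪ ∁ S) S-member)
                     (trans (p∪∁p≡⊤ S) (sym (singleton-full res single))))
  ... | no u≢j₀  = trans (merged-other u≢j₀) (updateAt-minimal u j₀ C u≢j₀)

  split-resolution : IsResolution n CS (c j₀ ∷ c)
  split-resolution = isResolution-cong (λ _ → refl) labels
    (lifted-resolution S-apart (isResolution-cong (sym ∘ merged≗C) (λ _ → refl) res))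
    where
    labels : c ∘ restore ≗ c j₀ ∷ c
    labels zero    = cong c restore-d
    labels (suc j) = cong c (restore-punchIn j)
    S-apart : ∀ {x} → x ∈ CS zero → x ∈ CS (suc j₀) → ⊥
    S-apart x∈∁S x∈ = x∈∁p⇒x∉p x∈∁S (subst (_ ∈_) S-member x∈)

  coincide : ∀ {b} → IsResolution n CS b → b zero ≡ b (suc j₀) → SamePartition (c j₀ ∷ c) b
  coincide {b} res-b eq = samePartition-cong (λ _ → refl) b-η (samePartition-∷ (proj₂ ur (b ∘ suc) res-suc) j₀)
    where
    res-suc : IsResolution n C (b ∘ suc)
    res-suc = isResolution-cong merged≗C (λ _ → refl) (merged-resolution {c = b} eq res-b)
    b-η : b (suc j₀) ∷ (b ∘ suc) ≗ b
    b-η zero    = sym eq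
    b-η (suc j) = refl

  refines-restrict : ∀ {a T} → a ≢ j₀ → ClassRefines CS (c j₀ ∷ c) (c a) T → ClassRefines C c (c a) T
  refines-restrict {a} {T} a≢j₀ ref j cj≡ca =
    subst (λ U → U ⊆ T ⊎ U ⊆ ∁ T) (updateAt-minimal j j₀ C j≢j₀) (ref (suc j) cj≡ca)
    where
    j≢j₀ : j ≢ j₀
    j≢j₀ j≡j₀ = a≢j₀ (single (trans (sym cj≡ca) (cong c j≡j₀)))

  module _ {b : Fin (suc k) → Fin n} (res-b : IsResolution n CS b) (X≢Y : b zero ≢ b (suc j₀)) where

    private
      class : ∀ l → Tiles CS (λ t → b t ≡ l) ⊤
      class = resolution⇒tiles res-b
      A : Fin (suc k) → Set
      A t = b t ≡ b zero × t ≢ zero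
      A? : Decidable A
      A? t = (b t ≟ b zero) ×-dec ¬? (t ≟ zero)
      A-tiles : Tiles CS A S
      A-tiles = subst (Tiles CS A) (∁∁ S) (tiles-diff (class (b zero)) (cong b) (tiles-singleton zero))
      A'-tiles : Tiles CS (_≡ suc j₀) S
      A'-tiles = subst (Tiles CS (_≡ suc j₀)) S-member (tiles-singleton (suc j₀))

    open Exchange res-b X≢Y A? (_≟ suc j₀) proj₁ (cong b) A-tiles A'-tiles
      using (relabel; relabel-unmoved; relabel≡X⁺; relabel≡Y⁺; relabel-resolution; relabel-refines)

    -- Swapping S with the members of the class of ∁ S that cover S joins S and ∁ S, so by
    -- uniqueness the class receiving those members is a class of c that S refines.
    separated : ∀ {x} → x ∈ S → ¬ (∀ i → ¬ ClassRefines C c i S)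
    separated {x} x∈S crosses with covers (class (b zero)) (∈⊤ {x = x})
    ... | zero  , _  , x∈∁S = x∈∁p⇒x∉p x∈∁S x∈S
    ... | suc a , ba , _    =
      crosses (c a) (refines-restrict a≢j₀ (classRefines-transfer sp (suc a)
        (λ j eq → relabel-refines j (trans eq (relabel≡Y⁺ (inj₁ (ba , λ ())))))))
      where
      a≢j₀ : a ≢ j₀
      a≢j₀ refl = X≢Y (sym ba)
      sp : SamePartition (c j₀ ∷ c) relabel
      sp = coincide (relabel-resolution x)
             (trans (relabel-unmoved (λ (_ , ne) → ne refl) (λ ())) (sym (relabel≡X⁺ (inj₁ refl))))

  split-unique : Nonempty S → (∀ i → ¬ ClassRefines C c i S) → UniqueResolution n CS (c j₀ ∷ c)
  split-unique (x , x∈S) crosses = split-resolution , λ b res-b → decide res-b (b zero ≟ b (suc j₀))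
    where
    decide : ∀ {b} → IsResolution n CS b → Dec (b zero ≡ b (suc j₀)) → SamePartition (c j₀ ∷ c) b
    decide res-b (yes eq)  = coincide res-b eq
    decide res-b (no X≢Y) = ⊥-elim (separated res-b X≢Y x∈S crosses)

member-crosses : ∀ {C : Family k m} {c : Fin k → Fin n} → UniqueResolution n C c →
                 ∀ {d d'} → d ≢ d' → c d ≡ c d' → Nonempty (C d) →
                 ∀ {i} → i ≢ c d → ¬ ClassRefines C c i (C d)
member-crosses {C = C} {c} (res , unique) {d} {d'} d≢d' cd≡cd' (x , _) {i} i≢cd ref =
  i≢cd (trans (sym relabel-d) (trans (Equivalence.to (unique relabel (relabel-resolution x) d d') cd≡cd')
                                     (trans relabel-d' (sym cd≡cd'))))
  where
  cd≢i : c d ≢ i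
  cd≢i cd≡i = i≢cd (sym cd≡i)
  inside-d? : Decidable (λ j → c j ≡ i × C j ⊆ C d)
  inside-d? j = (c j ≟ i) ×-dec (C j ⊆? C d)
  open Exchange res cd≢i (_≟ d) inside-d? (cong c) proj₁ (tiles-singleton d)
                (tiles-restrict (resolution⇒tiles res i) ref)
    using (relabel; relabel-unmoved; relabel≡Y⁺; relabel-resolution)
  relabel-d : relabel d ≡ i
  relabel-d = relabel≡Y⁺ (inj₁ refl)
  relabel-d' : relabel d' ≡ c d'
  relabel-d' = relabel-unmoved (λ d'≡d → d≢d' (sym d'≡d))
                               (λ (cd'≡i , _) → i≢cd (trans (sym cd'≡i) (sym cd≡cd')))

nonmember-crosses : ∀ {C : Family k m} {c : Fin k → Fin n} {S} → IsResolution n C c → ¬ ThreeInClass c →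
                    Nonempty S → Nonempty (∁ S) → (∀ j → C j ≢ S) → ∀ i → ¬ ClassRefines C c i S
nonmember-crosses {C = C} {c} {S} res ¬three (x , x∈S) (y , y∈∁S) nonmember i ref =
  go (covers inner x∈S) (covers (resolution⇒tiles res i) (∈⊤ {x = y}))
  where
  inner : Tiles C (λ j → c j ≡ i × C j ⊆ S) S
  inner = tiles-restrict (resolution⇒tiles res i) ref
  go : (∃ λ a → (c a ≡ i × C a ⊆ S) × x ∈ C a) → (∃ λ b → c b ≡ i × y ∈ C b) → ⊥
  go (a , (ca , a⊆S) , x∈a) (b , cb , y∈b) = nonmember a (⊆-antisym a⊆S S⊆a)
    where
    b⊆∁S : C b ⊆ ∁ S
    b⊆∁S with ref b cb
    ... | inj₁ b⊆S  = ⊥-elim (x∈∁p⇒x∉p y∈∁S (b⊆S y∈b))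
    ... | inj₂ b⊆∁S = b⊆∁S
    a≢b : a ≢ b
    a≢b refl = x∈∁p⇒x∉p (b⊆∁S x∈a) x∈S
    S⊆a : S ⊆ C a
    S⊆a {z} z∈S with covers inner z∈S
    ... | t , (ct , _) , z∈t with t ≟ a | t ≟ b
    ...   | yes refl | _        = z∈t
    ...   | no _     | yes refl = ⊥-elim (x∈∁p⇒x∉p (b⊆∁S z∈t) z∈S)
    ...   | no t≢a   | no t≢b   =
      ⊥-elim (¬three (a , b , t , a≢b , (λ a≡t → t≢a (sym a≡t)) , (λ b≡t → t≢b (sym b≡t)) ,
                      trans cb (sym ca) , trans ct (sym ca)))

-- Counting subsets

funToFin-cong : ∀ {m n} {f g : Fin m → Fin n} → f ≗ g → funToFin f ≡ funToFin g
funToFin-cong {zero}  _   = refl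
funToFin-cong {suc m} f≗g = cong₂ combine (f≗g zero) (funToFin-cong (f≗g ∘ suc))

subset-injection-bound : ∀ (f : Subset m → Fin n × Bool) → (∀ {S S'} → f S ≡ f S' → S ≡ S') → 2 ^ m ≤ n * 2
subset-injection-bound {m} {n} f f-injective =
  injective⇒≤ {f = code ∘ f ∘ toSubset} (toSubset-injective ∘ f-injective ∘ code-injective)
  where
  open Inverse 2↔Bool using (to; from; strictlyInverseˡ; strictlyInverseʳ)
  toSubset : Fin (2 ^ m) → Subset m
  toSubset i = tabulate (to ∘ finToFun i)
  toSubset-injective : ∀ {i i'} → toSubset i ≡ toSubset i' → i ≡ i'
  toSubset-injective {i} {i'} eq =
    trans (sym (funToFin-finToFin {m} {2} i)) (trans (funToFin-cong pointwise) (funToFin-finToFin {m} {2} i'))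
    where
    pointwise : finToFun i ≗ finToFun i'
    pointwise x = trans (sym (strictlyInverseʳ _)) (trans (cong from
      (trans (sym (lookup∘tabulate _ x)) (trans (cong (λ S → lookup S x) eq) (lookup∘tabulate _ x))))
      (strictlyInverseʳ _))
  code : Fin n × Bool → Fin (n * 2)
  code (a , b) = combine a (from b)
  code-injective : ∀ {p q} → code p ≡ code q → p ≡ q
  code-injective {a , b} {a' , b'} eq =
    let (a≡a' , fb≡fb') = combine-injective a (from b) a' (from b') eq in
    cong₂ _,_ a≡a' (trans (sym (strictlyInverseˡ b)) (trans (cong to fb≡fb') (strictlyInverseˡ b')))

-- Two members of a class with at most two members that agree on the point 0
-- coincide.
module _ {C : Family k (suc m)} {c : Fin k → Fin n} (res : IsResolution n C c) (¬three : ¬ ThreeInClass c)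
         {j₀} (single : SingletonClass c j₀) (member : ∀ S → Nonempty S → ∃ λ j → C j ≡ S) where

  private
    code : Subset (suc m) → Fin n × Bool
    code S with nonempty? S
    ... | no _   = c j₀ , false
    ... | yes ne = c (proj₁ (member S ne)) , does (zero ∈? S)

    member-code≢empty-code : ∀ j → (c j , does (zero ∈? C j)) ≢ (c j₀ , false)
    member-code≢empty-code j eq = true≢false (trans (sym (dec-true (zero ∈? C j) zero∈)) (cong proj₂ eq))
      where
      true≢false : Bool.true ≢ false
      true≢false ()
      zero∈ : zero ∈ C j
      zero∈ = subst (λ i → zero ∈ C i) (sym (single (cong proj₁ eq)))
                (subst (zero ∈_) (sym (singleton-full res single)) ∈⊤)

    same-member : ∀ {j j'} → (c j , does (zero ∈? C j)) ≡ (c j' , does (zero ∈? C j')) → C j ≡ C j'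
    same-member {j} {j'} eq with j ≟ j'
    ... | yes refl = refl
    ... | no j≢j' with zero ∈? C j | zero ∈? C j' | cong proj₂ eq
    ...   | yes z∈ | yes z∈' | _  = ⊥-elim (members-disjoint res (cong proj₁ eq) j≢j' z∈ z∈')
    ...   | yes _  | no _    | ()
    ...   | no _   | yes _   | ()
    ...   | no z∉  | no z∉'  | _  with covers (resolution⇒tiles res (c j)) (∈⊤ {x = zero})
    ...     | t , ct , z∈t =
      ⊥-elim (¬three (j , j' , t , j≢j' , (λ { refl → z∉ z∈t }) , (λ { refl → z∉' z∈t }) ,
                      sym (cong proj₁ eq) , ct))

    code-injective : ∀ S S' → code S ≡ code S' → S ≡ S'
    code-injective S S' eq with nonempty? S | nonempty? S'
    ... | no ¬ne | no ¬ne' = empty-unique ¬ne ¬ne'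
    ... | no _   | yes ne' with member S' ne'
    ...   | j' , refl = ⊥-elim (member-code≢empty-code j' (sym eq))
    code-injective S S' eq | yes ne | no _ with member S ne
    ...   | j , refl = ⊥-elim (member-code≢empty-code j eq)
    code-injective S S' eq | yes ne | yes ne' with member S ne | member S' ne'
    ...   | j , refl | j' , refl = same-member eq

  every-subset-a-member⇒bound : 2 ^ suc m ≤ n * 2
  every-subset-a-member⇒bound = subset-injection-bound code (code-injective _ _)

≤∸1⇒< : ∀ {a b} → 0 < b → a ≤ b ∸ 1 → a < b
≤∸1⇒< {b = suc b} _ a≤b = s≤s a≤b

bound-contradiction : n ≤ 2 ^ m ∸ 1 → ¬ (2 ^ suc m ≤ n * 2)
bound-contradiction {n} {m} n≤ = <⇒≱ (subst (n * 2 <_) (*-comm (2 ^ m) 2) (*-monoˡ-< 2 (≤∸1⇒< (m^n>0 2 m) n≤)))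

-- Repairing singleton classes

hasTwo? : ∀ (c : Fin k → Fin n) i → Dec (HasTwo c i)
hasTwo? c i = any? λ j → any? λ j' → ¬? (j ≟ j') ×-dec (c j ≟ i) ×-dec (c j' ≟ i)

threeInClass? : ∀ (c : Fin k → Fin n) → Dec (ThreeInClass c)
threeInClass? c = any? λ a → any? λ b → any? λ t →
  ¬? (a ≟ b) ×-dec ¬? (a ≟ t) ×-dec ¬? (b ≟ t) ×-dec (c b ≟ c a) ×-dec (c t ≟ c a)

hasTwo-∷ : ∀ {c : Fin k → Fin n} {l i} → HasTwo c i → HasTwo (l ∷ c) i
hasTwo-∷ (j , j' , j≢j' , cj , cj') = suc j , suc j' , (λ eq → j≢j' (suc-injective eq)) , cj , cj'

¬hasTwo⇒singleton : ∀ {c : Fin k → Fin n} {j₀} → ¬ HasTwo c (c j₀) → SingletonClass c j₀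
¬hasTwo⇒singleton {j₀ = j₀} ¬two {j} cj≡cj₀ with j ≟ j₀
... | yes j≡j₀ = j≡j₀
... | no j≢j₀  = ⊥-elim (¬two (j , j₀ , j≢j₀ , cj≡cj₀ , refl))

labels : URFamily n m k → Fin k → Fin n
labels (_ , _ , c , _) = c

-- Merge a into b, then split the member j₀ of the singleton class into C a and ∁ (C a).
rebalance : ∀ {C : Family k m} {c : Fin k → Fin n} {j₀} → NonemptyMembers C → UniqueResolution n C c →
            SingletonClass c j₀ → ThreeInClass c →
            ∃ λ (F : URFamily n m k) → HasTwo (labels F) (c j₀) × (∀ {i} → HasTwo c i → HasTwo (labels F) i)
rebalance {k = zero} {j₀ = ()}
rebalance {k = suc k} {n = n} {C = C} {c} {j₀} nonempty ur single
          (a , b , t , a≢b , a≢t , b≢t , cb≡ca , ct≡ca) =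
  (split merged j₀' (C a) , split-nonempty (merged-nonempty nonempty) (nonempty a) ∁a-nonempty ,
   cM j₀' ∷ cM , Split.split-unique (merged-unique ur (sym cb≡ca)) singleM (C a) (nonempty a) crosses) ,
  (zero , suc j₀' , (λ ()) , cM-j₀' , cM-j₀') ,
  hasTwo-∷ ∘ merged-hasTwo
  where
  open Merge C a≢b
  cM : Fin k → Fin n
  cM = c ∘ punchIn a
  a∩b≡∅ : ∀ {x} → x ∈ C a → x ∈ C b → ⊥
  a∩b≡∅ = members-disjoint (proj₁ ur) (sym cb≡ca) a≢b
  ∁a-nonempty : Nonempty (∁ (C a))
  ∁a-nonempty = let (y , y∈b) = nonempty b in y , x∉p⇒x∈∁p (λ y∈a → a∩b≡∅ y∈a y∈b)
  j₀≢a : j₀ ≢ a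
  j₀≢a j₀≡a = a≢b (trans (sym j₀≡a) (sym (single (trans cb≡ca (cong c (sym j₀≡a))))))
  j₀' : Fin k
  j₀' = restore j₀
  cM-j₀' : cM j₀' ≡ c j₀
  cM-j₀' = cong c (punchIn-restore j₀≢a)
  singleM : SingletonClass cM j₀'
  singleM {u} eq = trans (sym (restore-punchIn u)) (cong restore (single (trans eq cM-j₀')))
  crosses : ∀ i → ¬ ClassRefines merged cM i (C a)
  crosses i ref with i ≟ c a
  ... | no i≢ca = member-crosses ur a≢b (sym cb≡ca) (nonempty a) i≢ca λ j cj≡i →
    side-⊆ (∈-merged j) (ref (restore j) (trans (label-restore {c = c} (sym cb≡ca) j) cj≡i))
  ... | yes refl with ref e (trans (cong c punchIn-e) cb≡ca)
  ...   | inj₁ e⊆a  = let (y , y∈b) = nonempty b in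
                      a∩b≡∅ (e⊆a (subst (λ u → y ∈ merged u) restore-d' (∈-merged b y∈b))) y∈b
  ...   | inj₂ e⊆∁a = let (x , x∈a) = nonempty a in
                      x∈∁p⇒x∉p (e⊆∁a (subst (λ u → x ∈ merged u) restore-d (∈-merged a x∈a))) x∈a
  restored : ∀ {j j' i} → j ≢ a → j' ≢ a → j ≢ j' → c j ≡ i → c j' ≡ i → HasTwo cM i
  restored j≢a j'≢a j≢j' cj cj' =
    _ , _ , (λ eq → j≢j' (restore-injective j≢a j'≢a eq)) ,
    trans (cong c (punchIn-restore j≢a)) cj , trans (cong c (punchIn-restore j'≢a)) cj'
  merged-hasTwo : ∀ {i} → HasTwo c i → HasTwo cM i
  merged-hasTwo {i} (j , j' , j≢j' , cj , cj') with i ≟ c a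
  ... | yes i≡ca = restored (λ b≡a → a≢b (sym b≡a)) (λ t≡a → a≢t (sym t≡a)) b≢t
                     (trans cb≡ca (sym i≡ca)) (trans ct≡ca (sym i≡ca))
  ... | no i≢ca  = restored (λ j≡a → i≢ca (trans (sym cj) (cong c j≡a)))
                     (λ j'≡a → i≢ca (trans (sym cj') (cong c j'≡a))) j≢j' cj cj'

singleton-without-three-absurd : ∀ {C : Family k (suc m)} {c : Fin k → Fin n} {j₀} →
                                 IsG n (suc m) k → n ≤ 2 ^ m ∸ 1 → NonemptyMembers C → UniqueResolution n C c →
                                 SingletonClass c j₀ → ¬ ThreeInClass c → ⊥
singleton-without-three-absurd {k = k} {m = m} {C = C} {c} {j₀} (_ , maximal) n≤ nonempty ur single ¬three
  with anySubset? (λ S → nonempty? S ×-dec nonempty? (∁ S) ×-dec all? (λ j → ¬? (C j ≟ₛ S)))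
... | yes (S , neS , ne∁S , nonmember) =
  1+n≰n (maximal (suc k) (split C j₀ S , split-nonempty nonempty neS ne∁S , c j₀ ∷ c ,
                          Split.split-unique ur single S neS
                            (nonmember-crosses (proj₁ ur) ¬three neS ne∁S nonmember)))
... | no ¬nonmember =
  bound-contradiction {m = m} n≤ (every-subset-a-member⇒bound (proj₁ ur) ¬three single member)
  where
  member : ∀ S → Nonempty S → ∃ λ j → C j ≡ S
  member S neS with nonempty? (∁ S)
  ... | no ¬ne∁S = j₀ , trans (singleton-full (proj₁ ur) single) (sym (∁-empty⇒⊤ ¬ne∁S))
  ... | yes ne∁S with any? (λ j → C j ≟ₛ S)
  ...   | yes found = found
  ...   | no ¬found = ⊥-elim (¬nonmember (S , neS , ne∁S , λ j eq → ¬found (j , eq)))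

improve : IsG n (suc m) k → n ≤ 2 ^ m ∸ 1 → (F : URFamily n (suc m) k) → ∀ i₀ →
          ∃ λ (F' : URFamily n (suc m) k) →
            HasTwo (labels F') i₀ × (∀ {i} → HasTwo (labels F) i → HasTwo (labels F') i)
improve isG n≤ F@(C , nonempty , c , ur) i₀ with hasTwo? c i₀
... | yes two = F , two , id
... | no ¬two with proj₁ (proj₁ ur) i₀
...   | j₀ , refl = rebalance nonempty ur single
                      (decidable-stable (threeInClass? c)
                        (singleton-without-three-absurd isG n≤ nonempty ur single))
  where
  single : SingletonClass c j₀
  single = ¬hasTwo⇒singleton ¬two

improve-all : IsG n (suc m) k → n ≤ 2 ^ m ∸ 1 → (is : List (Fin n)) → URFamily n (suc m) k →
              ∃ λ (F : URFamily n (suc m) k) → ∀ {i} → i ListMembership.∈ is → HasTwo (labels F) i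
improve-all isG n≤ List.[] F = F , λ ()
improve-all isG n≤ (i List.∷ is) F =
  let (F₁ , two₁) = improve-all isG n≤ is F
      (F₂ , two , preserve) = improve isG n≤ F₁ i
  in F₂ , λ { (here refl) → two ; (there i∈is) → preserve (two₁ i∈is) }

lemma17 : (n m : ℕ) → 1 ≤ n → 1 ≤ m → n ≤ 2 ^ (m ∸ 1) ∸ 1 →
    ∃ λ (k : ℕ) → IsG n m k ×
      (Σ (Family k m) λ C → NonemptyMembers C ×
        (∃ λ (c : Fin k → Fin n) → UniqueResolution n C c × BlocksAtLeastTwo c))
lemma17 n (suc m) _ _ n≤ =
  let (k , isG) = g-exists n m
      ((C , nonempty , c , ur) , two) = improve-all isG n≤ (allFin n) (proj₁ isG)
  in k , isG , C , nonempty , c , ur , λ i → two (∈-allFin i)
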